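{- Let $X,A,A',A''$ be preordered sets, $R\colon X\to A$, $R'\colon A\to A'$, $R''\colon A'\to A''$ monotone functions, and $\mu\in 2^{X}$. If $A$ is reducible to $A'$ along $R'$ with respect to $R$ and $\mu$, and $A'$ is reducible to $A''$ along $R''$ with respect to $R'\circ R$ and $\mu$, then $A$ is reducible to $A''$ along $R''\circ R'$ with respect to $R$ and $\mu$.
   Context: $2=\{\bot<\top\}$. For a preordered set $X$, $2^{X}$ is the set of monotone functions $X\to 2$ (identified with up-closed subsets), ordered by inclusion. For monotone $R\colon X\to A$, $R^{*}\colon 2^{A}\to 2^{X}$ is $R^{*}\nu=\nu\circ R$. The upper approximation $\overline{R}\colon 2^{X}\to 2^{A}$ is the left adjoint of $R^{*}$ ($\overline{R}\mu\subseteq\nu$ iff $\mu\subseteq R^{*}\nu$), and the lower approximation $\underline{R}$ is the right adjoint of $R^{*}$ ($\nu\subseteq\underline{R}\mu$ iff $R^{*}\nu\subseteq\mu$). Given monotone $S\colon X\to B$ and $\mu\in 2^{X}$, $B$ is reducible to $B'$ along monotone $T\colon B\to B'$ (with respect to $S$ and $\mu$) if $T^{*}(\overline{T\circ S}\,\mu)=\overline{S}\mu$ and $T^{*}(\underline{T\circ S}\,\mu)=\underline{S}\mu$. -}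

module Defs where

open import Level using (Level; _⊔_; suc)
open import Data.Product using (Σ; _×_; _,_)
open import Relation.Binary.Bundles using (Preorder)

private variable
  a b c ℓ₁ ℓ₂ ℓ₃ ℓ₄ ℓ₅ ℓ₆ p q : Level

record Monotone (P : Preorder a ℓ₁ ℓ₂) (Q : Preorder b ℓ₃ ℓ₄) : Set (a ⊔ b ⊔ ℓ₂ ⊔ ℓ₄) where
  private
    module P = Preorder P
    module Q = Preorder Q
  field
    fun  : P.Carrier → Q.Carrier
    mono : ∀ {x y} → x P.≲ y → fun x Q.≲ fun y
open Monotone public

_∘ᴹ_ : {P : Preorder a ℓ₁ ℓ₂} {Q : Preorder b ℓ₃ ℓ₄} {S : Preorder c ℓ₅ ℓ₆} →
       Monotone Q S → Monotone P Q → Monotone P S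
fun (g ∘ᴹ f) x = fun g (fun f x)
mono (g ∘ᴹ f) le = mono g (mono f le)

-- 2^X : monotone maps X → 2, i.e. up-closed subsets (predicates) of X
record UpSet (P : Preorder a ℓ₁ ℓ₂) (p : Level) : Set (a ⊔ ℓ₂ ⊔ suc p) where
  private module P = Preorder P
  field
    _∋_     : P.Carrier → Set p
    upclosed : ∀ {x y} → x P.≲ y → _∋_ x → _∋_ y
open UpSet public

_⊆_ : {P : Preorder a ℓ₁ ℓ₂} → UpSet P p → UpSet P q → Set (a ⊔ p ⊔ q)
μ ⊆ ν = ∀ x → μ ∋ x → ν ∋ x

_≐_ : {P : Preorder a ℓ₁ ℓ₂} → UpSet P p → UpSet P q → Set (a ⊔ p ⊔ q)
μ ≐ ν = (μ ⊆ ν) × (ν ⊆ μ)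

module _ {X : Preorder a ℓ₁ ℓ₂} {A : Preorder b ℓ₃ ℓ₄} (R : Monotone X A) where
  private
    module X = Preorder X
    module A = Preorder A

  -- R* ν = ν ∘ R
  pullback : UpSet A p → UpSet X p
  pullback ν ∋ x = ν ∋ fun R x
  upclosed (pullback ν) le = upclosed ν (mono R le)

  -- upper approximation: left adjoint of R* (explicit formula:
  --   a ∈ upper μ  iff  ∃ x ∈ μ with R x ≲ a)
  upper : UpSet X p → UpSet A (a ⊔ ℓ₄ ⊔ p)
  upper μ ∋ y = Σ X.Carrier (λ x → (μ ∋ x) × (fun R x A.≲ y))
  upclosed (upper μ) le (x , m , r) = x , m , A.trans r le

  -- lower approximation: right adjoint of R* (explicit formula:
  --   a ∈ lower μ  iff  ∀ x, a ≲ R x → x ∈ μ)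
  lower : UpSet X p → UpSet A (a ⊔ ℓ₄ ⊔ p)
  lower μ ∋ y = ∀ x → y A.≲ fun R x → μ ∋ x
  upclosed (lower μ) le f x r = f x (A.trans le r)

Reducible : {X : Preorder a ℓ₁ ℓ₂} {B : Preorder b ℓ₃ ℓ₄} {B' : Preorder c ℓ₅ ℓ₆} →
            (S : Monotone X B) (μ : UpSet X p) (T : Monotone B B') → Set _
Reducible S μ T =
  (pullback T (upper (T ∘ᴹ S) μ) ≐ upper S μ) ×
  (pullback T (lower (T ∘ᴹ S) μ) ≐ lower S μ)

{-# OPTIONS --safe #-}
module Submission where

open import Level using (Level)
open import Data.Product using (_,_)
open import Relation.Binary.Bundles using (Preorder)
open import Defs

private variable
  a b c ℓ₁ ℓ₂ ℓ₃ ℓ₄ ℓ₅ ℓ₆ p q r : Level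

-- Pulling back along T' ∘ᴹ T is, definitionally, pulling back along T' and
-- then along T; so a ≐ for T' transported along T chains with a ≐ for T.
pullback-∘ᴹ-≐ : {P : Preorder a ℓ₁ ℓ₂} {Q : Preorder b ℓ₃ ℓ₄} {S : Preorder c ℓ₅ ℓ₆}
                (T : Monotone P Q) (T' : Monotone Q S)
                (α : UpSet S p) (β : UpSet Q q) (γ : UpSet P r) →
                pullback T' α ≐ β → pullback T β ≐ γ → pullback (T' ∘ᴹ T) α ≐ γ
pullback-∘ᴹ-≐ T T' α β γ (α⊆β , β⊆α) (β⊆γ , γ⊆β) =
  (λ x x∈α → β⊆γ x (α⊆β (fun T x) x∈α)) ,
  (λ x x∈γ → β⊆α (fun T x) (γ⊆β x x∈γ))

theorem5 : ∀ {x₁ x₂ x₃ a₁ a₂ a₃ b₁ b₂ b₃ c₁ c₂ c₃ p : Level}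
    {X : Preorder x₁ x₂ x₃} {A : Preorder a₁ a₂ a₃}
    {A' : Preorder b₁ b₂ b₃} {A'' : Preorder c₁ c₂ c₃}
    (R : Monotone X A) (R' : Monotone A A') (R'' : Monotone A' A'')
    (μ : UpSet X p) →
    Reducible R μ R' →
    Reducible (R' ∘ᴹ R) μ R'' →
    Reducible R μ (R'' ∘ᴹ R')
-- The second hypothesis speaks of R'' ∘ᴹ (R' ∘ᴹ R), the goal of (R'' ∘ᴹ R') ∘ᴹ R;
-- these agree definitionally by η for the Monotone record.
theorem5 R R' R'' μ (upper-R' , lower-R') (upper-R'' , lower-R'') =
  pullback-∘ᴹ-≐ R' R''
    (upper ((R'' ∘ᴹ R') ∘ᴹ R) μ) (upper (R' ∘ᴹ R) μ) (upper R μ) upper-R'' upper-R' ,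
  pullback-∘ᴹ-≐ R' R''
    (lower ((R'' ∘ᴹ R') ∘ᴹ R) μ) (lower (R' ∘ᴹ R) μ) (lower R μ) lower-R'' lower-R'
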